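{- For all natural numbers $n$ and $m\geq 3$, $$E_{c}(F_{n,m},x)=\sum_{i=0}^{n} \binom{n}{i} m^{i} x^{mn-i}.$$
   Context: $F_{n,m}$ is the generalized friendship graph: a collection of $n$ cycles, each of order $m$, meeting at a common vertex (and otherwise disjoint). For a finite simple graph $G$ with $m'$ edges, a connected edge cover set is a subset $S$ of edges such that every vertex of $G$ is incident to at least one edge of $S$ and the subgraph induced by $S$ (the edges of $S$ with their endpoints) is connected; $e_c(G,i)$ is the number of connected edge cover sets of size $i$, and $E_{c}(G,x)=\sum_{i=1}^{m'} e_{c}(G,i)x^{i}$. -}

module Defs where

open import Data.Nat using (ℕ; zero; suc; _+_; _*_; _∸_; _^_; _≤_; _<?_)
open import Data.Nat.Properties using (_≟_)
open import Data.Nat.Combinatorics using (_C_)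
open import Data.Fin using (Fin; toℕ; fromℕ<; remQuot)
open import Data.Fin.Subset using (Subset; _∈_; ∣_∣)
open import Data.List using (List; length; map; upTo)
open import Data.Nat.ListAction using (sum)
open import Data.List.Relation.Unary.Unique.Propositional using (Unique)
import Data.List.Membership.Propositional as LM
open import Data.Product using (_×_; _,_; proj₁; proj₂; Σ; ∃)
open import Data.Sum using (_⊎_)
open import Relation.Binary.PropositionalEquality using (_≡_)
open import Relation.Nullary using (yes; no)
open import Relation.Nullary.Decidable using (⌊_⌋)
open import Data.Bool using (if_then_else_)
open import Function.Bundles using (_⇔_)

record Graph : Set₁ where
  field
    V         : Set
    E         : ℕ
    endpoints : Fin E → V × V
open Graph public

Incident : (G : Graph) → V G → Fin (E G) → Set
Incident G v e = (proj₁ (endpoints G e) ≡ v) ⊎ (proj₂ (endpoints G e) ≡ v)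

Covered : (G : Graph) → Subset (E G) → V G → Set
Covered G S v = ∃ λ e → e ∈ S × Incident G v e

data Reach (G : Graph) (S : Subset (E G)) : V G → V G → Set where
  here : ∀ {u} → Reach G S u u
  step : ∀ {u w v} (e : Fin (E G)) → e ∈ S → Incident G u e → Incident G w e →
         Reach G S w v → Reach G S u v

IsConnectedEdgeCover : (G : Graph) → Subset (E G) → Set
IsConnectedEdgeCover G S =
  ((v : V G) → Covered G S v) ×
  ((u v : V G) → Covered G S u → Covered G S v → Reach G S u v)

-- "the number of S with P S is k": a duplicate-free list enumerating exactly
-- the subsets satisfying P, of length k.
CountIs : ∀ {n} → (Subset n → Set) → ℕ → Set
CountIs {n} P k = Σ (List (Subset n)) λ L →
  Unique L × ((S : Subset n) → (S LM.∈ L) ⇔ P S) × (length L ≡ k)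

ecIs : (G : Graph) → ℕ → ℕ → Set
ecIs G i k = CountIs (λ S → IsConnectedEdgeCover G S × (∣ S ∣ ≡ i)) k

-- Generalized friendship graph F_{n,m}: n cycles of order m sharing
-- one common vertex (center).  Cycle j has vertices at positions
-- 0..m-1, position 0 being the center, position p ≥ 1 being node j (p-1).

data FVertex (n m : ℕ) : Set where
  center : FVertex n m
  node   : Fin n → Fin (m ∸ 1) → FVertex n m

pos : (n m : ℕ) → Fin n → ℕ → FVertex n m
pos n m j zero = center
pos n m j (suc p) with p <? (m ∸ 1)
... | yes lt = node j (fromℕ< lt)
... | no _   = center

-- edge k of cycle j joins positions k and k+1 (mod m)
friendship : ℕ → ℕ → Graph
friendship n m = record
  { V = FVertex n m
  ; E = n * m
  ; endpoints = λ e → let jk = remQuot {n} m e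
                          j = proj₁ jk ; k = toℕ (proj₂ jk)
                      in pos n m j k , pos n m j (suc k)
  }

-- coefficient of x^i in  Σ_{j=0}^{n} (n choose j) m^j x^{mn-j}
rhsCoeff : ℕ → ℕ → ℕ → ℕ
rhsCoeff n m i =
  sum (map (λ j → if ⌊ (m * n ∸ j) ≟ i ⌋ then (n C j) * m ^ j else 0)
           (upTo (suc n)))

-- Edge k of cycle j of F_{n,m} is the edge numbered combine j k, so an edge set S ⊆ Fin (n * m)
-- splits into n blocks of m edges, one block per cycle. S is a connected edge cover exactly when
-- every cycle misses at most one of its edges: if cycle j misses edges a < b, the S-edges at the
-- nodes strictly between a and b never leave that stretch, so those nodes cannot reach the centre;
-- if cycle j misses at most edge g, each of its nodes walks to the centre along the side of the
-- cycle away from g. Hence the covers with nm - d edges are the edge sets with d missing edges in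
-- d distinct cycles, and there are (n choose d) m^d of them. The count follows Pascal's rule: the
-- first block misses no edge, or exactly one of its m edges.

module Submission where

open import Defs
open import Data.Bool using (if_then_else_)
open import Data.Fin using (Fin; zero; suc; toℕ; fromℕ<; combine; remQuot)
open import Data.Fin.Properties as Fin
  using (all?; toℕ<n; toℕ-injective; toℕ-fromℕ<; fromℕ<-toℕ; remQuot-combine; combine-remQuot)
open import Data.Fin.Subset using (Subset; inside; outside; ∁; ∣_∣; _∈_; _∉_)
open import Data.Fin.Subset.Properties using (_∈?_; drop-there; ∣p∣≤n; ∣∁p∣≡n∸∣p∣)
open import Data.List as List using ([]; _∷_; [_]; applyUpTo)
open import Data.List.Properties using (length-++; length-map; map-upTo)
open import Data.List.Membership.Propositional using () renaming (_∈_ to _∈ₗ_)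
open import Data.List.Membership.Propositional.Properties
  using (∈-map⁺; ∈-map⁻; ∈-++⁺ˡ; ∈-++⁺ʳ; ∈-++⁻)
open import Data.List.Relation.Unary.Any using (here)
import Data.List.Relation.Unary.All as All
import Data.List.Relation.Unary.AllPairs as AllPairs
open import Data.List.Relation.Unary.Unique.Propositional.Properties using (++⁺; map⁺)
open import Data.Nat
  using ( ℕ; zero; suc; >-nonZero; _+_; _*_; _∸_; _^_; _≤_; _<_; _≤′_; _≤?_; _<?_
        ; z≤n; s≤s; s≤s⁻¹; ≤′-refl; ≤′-step )
open import Data.Nat.Combinatorics using (_C_; nCk+nC[k+1]≡[n+1]C[k+1]; k>n⇒nCk≡0)
open import Data.Nat.ListAction using (sum)
open import Data.Nat.Properties
  using ( _≟_; +-identityʳ; *-zeroʳ; *-comm; suc-injective; n≤0⇒n≡0; ≤-reflexive; ≤-refl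
        ; ≤-trans; <⇒≤; <-irrefl; ≤-<-trans; <-≤-trans; ≤∧≢⇒<; m<n⇒m<1+n; ≰⇒>; <⇒≢; <⇒≱
        ; ≤⇒≤′; ≤′⇒≤; z≤′n; ∸-monoˡ-≤; ∸-cancelˡ-≡; m∸[m∸n]≡n; m∸n≤m; m≤m*n )
open import Data.Nat.Tactic.RingSolver using (solve-∀)
open import Data.Product using (_×_; _,_; proj₁; proj₂; ∃)
open import Data.Product.Function.NonDependent.Propositional using (_×-⇔_)
open import Data.Sum using (_⊎_; inj₁; inj₂)
open import Data.Vec using (_∷_; _++_; lookup; tabulate; here; there) renaming ([] to ⟨⟩)
open import Data.Vec.Properties
  using ( ∷-injectiveʳ; []=⇒lookup; lookup⇒[]=; lookup∘tabulate; lookup-++ˡ; lookup-++ʳ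
        ; tabulate-cong; tabulate∘lookup )
open import Function using (_∘_)
open import Function.Bundles using (_⇔_; mk⇔; Equivalence)
open import Function.Construct.Composition using (_⇔-∘_)
open import Function.Construct.Symmetry using (⇔-sym)
open import Relation.Binary using (tri<; tri≈; tri>)
open import Relation.Binary.PropositionalEquality
  using (_≡_; _≢_; refl; sym; trans; cong; cong₂; subst; subst₂; _≗_; module ≡-Reasoning)
open import Relation.Nullary using (Dec; yes; no; ¬_; contradiction; _×-dec_)
open import Relation.Nullary.Decidable using (decidable-stable; ⌊_⌋)
open import Relation.Unary using (Decidable)

open Equivalence using (to; from)

-- Counting subsets

∑ : (k : ℕ) → (Subset k → ℕ) → ℕ
∑ zero    f = f ⟨⟩
∑ (suc k) f = ∑ k (f ∘ (inside ∷_)) + ∑ k (f ∘ (outside ∷_))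

𝟙 : {P : Set} → Dec P → ℕ
𝟙 (yes _) = 1
𝟙 (no _)  = 0

count : ∀ {k} {P : Subset k → Set} → Decidable P → ℕ
count {k} P? = ∑ k (𝟙 ∘ P?)

countIs-∷ : ∀ {k a b} {P : Subset (suc k) → Set} →
            CountIs (P ∘ (inside ∷_)) a → CountIs (P ∘ (outside ∷_)) b → CountIs P (a + b)
countIs-∷ {P = P} (L₁ , !L₁ , L₁⇔P , |L₁|) (L₂ , !L₂ , L₂⇔P , |L₂|) =
  L₁′ List.++ L₂′ ,
  ++⁺ (map⁺ ∷-injectiveʳ !L₁) (map⁺ ∷-injectiveʳ !L₂) disjoint ,
  (λ S → mk⇔ ∈L⇒P (P⇒∈L S)) ,
  trans (length-++ L₁′) (cong₂ _+_ (trans (length-map _ L₁) |L₁|) (trans (length-map _ L₂) |L₂|))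
  where
  L₁′ = List.map (inside ∷_) L₁
  L₂′ = List.map (outside ∷_) L₂

  disjoint : ∀ {S} → ¬ (S ∈ₗ L₁′ × S ∈ₗ L₂′)
  disjoint (S∈₁ , S∈₂) with ∈-map⁻ (inside ∷_) S∈₁ | ∈-map⁻ (outside ∷_) S∈₂
  ... | _ , _ , refl | _ , _ , ()

  ∈L⇒P : ∀ {S} → S ∈ₗ L₁′ List.++ L₂′ → P S
  ∈L⇒P S∈ with ∈-++⁻ L₁′ S∈
  ... | inj₁ S∈₁ with _ , S∈L₁ , refl ← ∈-map⁻ (inside ∷_) S∈₁ = to (L₁⇔P _) S∈L₁
  ... | inj₂ S∈₂ with _ , S∈L₂ , refl ← ∈-map⁻ (outside ∷_) S∈₂ = to (L₂⇔P _) S∈L₂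

  P⇒∈L : ∀ S → P S → S ∈ₗ L₁′ List.++ L₂′
  P⇒∈L (inside  ∷ S) PS = ∈-++⁺ˡ (∈-map⁺ (inside ∷_) (from (L₁⇔P S) PS))
  P⇒∈L (outside ∷ S) PS = ∈-++⁺ʳ L₁′ (∈-map⁺ (outside ∷_) (from (L₂⇔P S) PS))

countIs-count : ∀ {k} {P : Subset k → Set} (P? : Decidable P) → CountIs P (count P?)
countIs-count {zero} P? with P? ⟨⟩
... | yes P⟨⟩ = [ ⟨⟩ ] , All.[] AllPairs.∷ AllPairs.[] ,
                (λ { ⟨⟩ → mk⇔ (λ _ → P⟨⟩) (λ _ → here refl) }) , refl
... | no ¬P⟨⟩ = [] , AllPairs.[] , (λ { ⟨⟩ → mk⇔ (λ ()) (λ P⟨⟩ → contradiction P⟨⟩ ¬P⟨⟩) }) , refl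
countIs-count {suc k} P? =
  countIs-∷ (countIs-count (P? ∘ (inside ∷_))) (countIs-count (P? ∘ (outside ∷_)))

countIs-cong : ∀ {k c} {P Q : Subset k → Set} → (∀ S → P S ⇔ Q S) → CountIs P c → CountIs Q c
countIs-cong P⇔Q (L , !L , L⇔P , |L|) = L , !L , (λ S → P⇔Q S ⇔-∘ L⇔P S) , |L|

countIs-none : ∀ {k} {P : Subset k → Set} → (∀ S → ¬ P S) → CountIs P 0
countIs-none ¬P = [] , AllPairs.[] , (λ S → mk⇔ (λ ()) (λ PS → contradiction PS (¬P S))) , refl

𝟙-cong : {P Q : Set} → P ⇔ Q → (P? : Dec P) (Q? : Dec Q) → 𝟙 P? ≡ 𝟙 Q?
𝟙-cong P⇔Q (yes _) (yes _) = refl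
𝟙-cong P⇔Q (yes P) (no ¬Q) = contradiction (to P⇔Q P) ¬Q
𝟙-cong P⇔Q (no ¬P) (yes Q) = contradiction (from P⇔Q Q) ¬P
𝟙-cong P⇔Q (no _)  (no _)  = refl

𝟙-no : {P : Set} → ¬ P → (P? : Dec P) → 𝟙 P? ≡ 0
𝟙-no ¬P (yes P) = contradiction P ¬P
𝟙-no ¬P (no _)  = refl

∑-cong : ∀ k {f g : Subset k → ℕ} → f ≗ g → ∑ k f ≡ ∑ k g
∑-cong zero    f≗g = f≗g ⟨⟩
∑-cong (suc k) f≗g = cong₂ _+_ (∑-cong k (f≗g ∘ (inside ∷_))) (∑-cong k (f≗g ∘ (outside ∷_)))

∑-zero : ∀ k {f : Subset k → ℕ} → (∀ p → f p ≡ 0) → ∑ k f ≡ 0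
∑-zero zero    f≡0 = f≡0 ⟨⟩
∑-zero (suc k) f≡0 = cong₂ _+_ (∑-zero k (f≡0 ∘ (inside ∷_))) (∑-zero k (f≡0 ∘ (outside ∷_)))

∑-++ : ∀ a {b} (f : Subset (a + b) → ℕ) → ∑ (a + b) f ≡ ∑ a (λ p → ∑ b (λ q → f (p ++ q)))
∑-++ zero    f = refl
∑-++ (suc a) f = cong₂ _+_ (∑-++ a (f ∘ (inside ∷_))) (∑-++ a (f ∘ (outside ∷_)))

∑-∣∁∣ : ∀ k (H : ℕ → ℕ) → (∀ z → H (2 + z) ≡ 0) → ∑ k (λ p → H ∣ ∁ p ∣) ≡ H 0 + k * H 1
∑-∣∁∣ zero    H _     = sym (+-identityʳ (H 0))
∑-∣∁∣ (suc k) H H₂₊≡0 = begin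
  ∑ k (λ p → H ∣ ∁ p ∣) + ∑ k (λ p → H (suc ∣ ∁ p ∣))
    ≡⟨ cong₂ _+_ (∑-∣∁∣ k H H₂₊≡0) (∑-∣∁∣ k (H ∘ suc) (H₂₊≡0 ∘ suc)) ⟩
  (H 0 + k * H 1) + (H 1 + k * H 2)
    ≡⟨ cong (λ h → (H 0 + k * H 1) + (H 1 + k * h)) (H₂₊≡0 0) ⟩
  (H 0 + k * H 1) + (H 1 + k * 0)
    ≡⟨ regroup (H 0) (H 1) k ⟩
  H 0 + suc k * H 1 ∎
  where
  open ≡-Reasoning
  regroup : ∀ a b k → (a + k * b) + (b + k * 0) ≡ a + (b + k * b)
  regroup = solve-∀

count-cong : ∀ {k} {P Q : Subset k → Set} (P? : Decidable P) (Q? : Decidable Q) →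
             (∀ S → P S ⇔ Q S) → count P? ≡ count Q?
count-cong {k} P? Q? P⇔Q = ∑-cong k (λ S → 𝟙-cong (P⇔Q S) (P? S) (Q? S))

count-none : ∀ {k} {P : Subset k → Set} (P? : Decidable P) → (∀ S → ¬ P S) → count P? ≡ 0
count-none {k} P? ¬P = ∑-zero k (λ S → 𝟙-no (¬P S) (P? S))

∣∁-++∣ : ∀ {a b} (p : Subset a) (q : Subset b) → ∣ ∁ (p ++ q) ∣ ≡ ∣ ∁ p ∣ + ∣ ∁ q ∣
∣∁-++∣ ⟨⟩            q = refl
∣∁-++∣ (inside  ∷ p) q = ∣∁-++∣ p q
∣∁-++∣ (outside ∷ p) q = cong suc (∣∁-++∣ p q)

∣∁p∣≡0⇒x∈p : ∀ {k} {p : Subset k} → ∣ ∁ p ∣ ≡ 0 → ∀ x → x ∈ p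
∣∁p∣≡0⇒x∈p {p = inside ∷ p} _    zero    = here
∣∁p∣≡0⇒x∈p {p = inside ∷ p} ∁p≡0 (suc x) = there (∣∁p∣≡0⇒x∈p ∁p≡0 x)

∀x∈p⇒∣∁p∣≡0 : ∀ {k} {p : Subset k} → (∀ x → x ∈ p) → ∣ ∁ p ∣ ≡ 0
∀x∈p⇒∣∁p∣≡0 {p = ⟨⟩}          _  = refl
∀x∈p⇒∣∁p∣≡0 {p = inside  ∷ p} ∈p = ∀x∈p⇒∣∁p∣≡0 (drop-there ∘ ∈p ∘ suc)
∀x∈p⇒∣∁p∣≡0 {p = outside ∷ p} ∈p with ∈p zero
... | ()

∣∁p∣≤1⇒∈-except : ∀ {k} (p : Subset k) → ∣ ∁ p ∣ ≤ 1 → ∃ λ g → ∀ x → toℕ x ≢ g → x ∈ p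
∣∁p∣≤1⇒∈-except ⟨⟩            _ = 0 , λ ()
∣∁p∣≤1⇒∈-except (inside  ∷ p) ∁p≤1 with g , ∈p ← ∣∁p∣≤1⇒∈-except p ∁p≤1 =
  suc g , λ { zero _ → here ; (suc x) x≢g → there (∈p x (x≢g ∘ cong suc)) }
∣∁p∣≤1⇒∈-except (outside ∷ p) (s≤s ∁p≤0) =
  0 , λ { zero 0≢0 → contradiction refl 0≢0 ; (suc x) _ → there (∣∁p∣≡0⇒x∈p (n≤0⇒n≡0 ∁p≤0) x) }

gap-unique⇒∣∁p∣≤1 : ∀ {k} (p : Subset k) → (∀ {x y} → x ∉ p → y ∉ p → x ≡ y) → ∣ ∁ p ∣ ≤ 1
gap-unique⇒∣∁p∣≤1 ⟨⟩            _      = z≤n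
gap-unique⇒∣∁p∣≤1 (inside  ∷ p) unique =
  gap-unique⇒∣∁p∣≤1 p (λ x∉p y∉p → Fin.suc-injective (unique (x∉p ∘ drop-there) (y∉p ∘ drop-there)))
gap-unique⇒∣∁p∣≤1 (outside ∷ p) unique =
  s≤s (≤-reflexive (∀x∈p⇒∣∁p∣≡0 (λ x → decidable-stable (x ∈? p) (λ x∉p →
    Fin.0≢1+n (unique (λ ()) (x∉p ∘ drop-there))))))

∣∁p∣≡k∸i⇔∣p∣≡i : ∀ {k i} (p : Subset k) → i ≤ k → ∣ ∁ p ∣ ≡ k ∸ i ⇔ ∣ p ∣ ≡ i
∣∁p∣≡k∸i⇔∣p∣≡i {k} p i≤k = mk⇔
  (λ ∁p≡k∸i → ∸-cancelˡ-≡ (∣p∣≤n p) i≤k (trans (sym (∣∁p∣≡n∸∣p∣ p)) ∁p≡k∸i))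
  (λ p≡i → trans (∣∁p∣≡n∸∣p∣ p) (cong (k ∸_) p≡i))

-- Gaps in distinct blocks

block : ∀ {n} m → Subset (n * m) → Fin n → Subset m
block m S j = tabulate (λ k → lookup S (combine j k))

block-++-zero : ∀ {n} m (p : Subset m) (q : Subset (n * m)) → block {suc n} m (p ++ q) zero ≡ p
block-++-zero m p q = trans (tabulate-cong (lookup-++ˡ p q)) (tabulate∘lookup p)

block-++-suc : ∀ {n} m (p : Subset m) (q : Subset (n * m)) j →
               block {suc n} m (p ++ q) (suc j) ≡ block m q j
block-++-suc m p q j = tabulate-cong (λ k → lookup-++ʳ p q (combine j k))

∈-block⁺ : ∀ {n m} (S : Subset (n * m)) (j : Fin n) {k : Fin m} → combine j k ∈ S → k ∈ block m S j
∈-block⁺ S j {k} jk∈S =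
  lookup⇒[]= k _ (trans (lookup∘tabulate (λ k → lookup S (combine j k)) k) ([]=⇒lookup jk∈S))

∈-block⁻ : ∀ {n m} (S : Subset (n * m)) (j : Fin n) {k : Fin m} → k ∈ block m S j → combine j k ∈ S
∈-block⁻ S j {k} k∈block =
  lookup⇒[]= (combine j k) S
    (trans (sym (lookup∘tabulate (λ k → lookup S (combine j k)) k)) ([]=⇒lookup k∈block))

AtMostOneGapPerBlock : ∀ m n → Subset (n * m) → Set
AtMostOneGapPerBlock m n S = (j : Fin n) → ∣ ∁ (block m S j) ∣ ≤ 1

atMostOneGapPerBlock? : ∀ m n → Decidable (AtMostOneGapPerBlock m n)
atMostOneGapPerBlock? m n S = all? (λ (j : Fin n) → ∣ ∁ (block m S j) ∣ ≤? 1)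

atMostOneGapPerBlock-++ : ∀ m n (p : Subset m) (q : Subset (n * m)) →
  AtMostOneGapPerBlock m (suc n) (p ++ q) ⇔ (∣ ∁ p ∣ ≤ 1 × AtMostOneGapPerBlock m n q)
atMostOneGapPerBlock-++ m n p q = mk⇔
  (λ gaps≤1 → subst OneGap (block-++-zero {n} m p q) (gaps≤1 zero) ,
              λ j → subst OneGap (block-++-suc {n} m p q j) (gaps≤1 (suc j)))
  (λ { (p≤1 , q≤1) zero    → subst OneGap (sym (block-++-zero {n} m p q)) p≤1
     ; (p≤1 , q≤1) (suc j) → subst OneGap (sym (block-++-suc {n} m p q j)) (q≤1 j) })
  where
  OneGap : Subset m → Set
  OneGap b = ∣ ∁ b ∣ ≤ 1

GapsInDistinctBlocks : ∀ m n → ℕ → Subset (n * m) → Set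
GapsInDistinctBlocks m n d S = AtMostOneGapPerBlock m n S × ∣ ∁ S ∣ ≡ d

gapsInDistinctBlocks? : ∀ m n d → Decidable (GapsInDistinctBlocks m n d)
gapsInDistinctBlocks? m n d S = atMostOneGapPerBlock? m n S ×-dec (∣ ∁ S ∣ ≟ d)

module _ (m n d : ℕ) where

  GapsAfterFirstBlock : ℕ → Subset (n * m) → Set
  GapsAfterFirstBlock z q = z ≤ 1 × AtMostOneGapPerBlock m n q × z + ∣ ∁ q ∣ ≡ d

  gapsAfterFirstBlock? : ∀ z → Decidable (GapsAfterFirstBlock z)
  gapsAfterFirstBlock? z q = z ≤? 1 ×-dec atMostOneGapPerBlock? m n q ×-dec (z + ∣ ∁ q ∣ ≟ d)

  gapsInDistinctBlocks-++ : ∀ p q →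
    GapsInDistinctBlocks m (suc n) d (p ++ q) ⇔ GapsAfterFirstBlock ∣ ∁ p ∣ q
  gapsInDistinctBlocks-++ p q = mk⇔
    (λ (gaps≤1 , gaps≡d) → let p≤1 , q≤1 = to split gaps≤1
                           in p≤1 , q≤1 , trans (sym (∣∁-++∣ p q)) gaps≡d)
    (λ (p≤1 , q≤1 , gaps≡d) → from split (p≤1 , q≤1) , trans (∣∁-++∣ p q) gaps≡d)
    where
    split : AtMostOneGapPerBlock m (suc n) (p ++ q) ⇔ (∣ ∁ p ∣ ≤ 1 × AtMostOneGapPerBlock m n q)
    split = atMostOneGapPerBlock-++ m n p q

  count-by-first-block : count (gapsInDistinctBlocks? m (suc n) d) ≡
                         count (gapsAfterFirstBlock? 0) + m * count (gapsAfterFirstBlock? 1)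
  count-by-first-block = begin
    count (gapsInDistinctBlocks? m (suc n) d)
      ≡⟨ ∑-++ m _ ⟩
    ∑ m (λ p → ∑ (n * m) (λ q → 𝟙 (gapsInDistinctBlocks? m (suc n) d (p ++ q))))
      ≡⟨ ∑-cong m (λ p → count-cong _ _ (gapsInDistinctBlocks-++ p)) ⟩
    ∑ m (λ p → count (gapsAfterFirstBlock? ∣ ∁ p ∣))
      ≡⟨ ∑-∣∁∣ m (count ∘ gapsAfterFirstBlock?)
               (λ z → count-none (gapsAfterFirstBlock? (2 + z)) (λ { _ (s≤s () , _) })) ⟩
    count (gapsAfterFirstBlock? 0) + m * count (gapsAfterFirstBlock? 1) ∎
    where open ≡-Reasoning

count-noGapInFirstBlock : ∀ m n d →
  count (gapsAfterFirstBlock? m n d 0) ≡ count (gapsInDistinctBlocks? m n d)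
count-noGapInFirstBlock m n d =
  count-cong (gapsAfterFirstBlock? m n d 0) (gapsInDistinctBlocks? m n d)
             (λ _ → mk⇔ proj₂ (λ gaps → z≤n , gaps))

count-oneGapInFirstBlock : ∀ m n d →
  count (gapsAfterFirstBlock? m n (suc d) 1) ≡ count (gapsInDistinctBlocks? m n d)
count-oneGapInFirstBlock m n d =
  count-cong (gapsAfterFirstBlock? m n (suc d) 1) (gapsInDistinctBlocks? m n d) (λ _ → mk⇔
    (λ (_ , q≤1 , gaps≡1+d) → q≤1 , suc-injective gaps≡1+d)
    (λ (q≤1 , gaps≡d) → s≤s z≤n , q≤1 , cong suc gaps≡d))

pascal-power : ∀ n m d → (n C suc d) * m ^ suc d + m * ((n C d) * m ^ d) ≡ (suc n C suc d) * m ^ suc d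
pascal-power n m d = begin
  (n C suc d) * (m * m ^ d) + m * ((n C d) * m ^ d) ≡⟨ regroup (n C d) (n C suc d) m (m ^ d) ⟩
  (n C d + n C suc d) * (m * m ^ d)                ≡⟨ cong (_* (m * m ^ d)) (nCk+nC[k+1]≡[n+1]C[k+1] n d) ⟩
  (suc n C suc d) * (m * m ^ d)                    ∎
  where
  open ≡-Reasoning
  regroup : ∀ a b m x → b * (m * x) + m * (a * x) ≡ (a + b) * (m * x)
  regroup = solve-∀

count-gapsInDistinctBlocks : ∀ m n d → count (gapsInDistinctBlocks? m n d) ≡ (n C d) * m ^ d
count-gapsInDistinctBlocks m zero    zero    = refl
count-gapsInDistinctBlocks m zero    (suc d) = refl
count-gapsInDistinctBlocks m (suc n) zero    = begin
  count (gapsInDistinctBlocks? m (suc n) 0)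
    ≡⟨ count-by-first-block m n 0 ⟩
  count (gapsAfterFirstBlock? m n 0 0) + m * count (gapsAfterFirstBlock? m n 0 1)
    ≡⟨ cong₂ (λ a b → a + m * b) (count-noGapInFirstBlock m n 0)
                                  (count-none (gapsAfterFirstBlock? m n 0 1) (λ { _ (_ , _ , ()) })) ⟩
  count (gapsInDistinctBlocks? m n 0) + m * 0
    ≡⟨ cong₂ _+_ (count-gapsInDistinctBlocks m n 0) (*-zeroʳ m) ⟩
  1 ∎
  where open ≡-Reasoning
count-gapsInDistinctBlocks m (suc n) (suc d) = begin
  count (gapsInDistinctBlocks? m (suc n) (suc d))
    ≡⟨ count-by-first-block m n (suc d) ⟩
  count (gapsAfterFirstBlock? m n (suc d) 0) + m * count (gapsAfterFirstBlock? m n (suc d) 1)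
    ≡⟨ cong₂ (λ a b → a + m * b) (count-noGapInFirstBlock m n (suc d)) (count-oneGapInFirstBlock m n d) ⟩
  count (gapsInDistinctBlocks? m n (suc d)) + m * count (gapsInDistinctBlocks? m n d)
    ≡⟨ cong₂ (λ a b → a + m * b) (count-gapsInDistinctBlocks m n (suc d))
                                  (count-gapsInDistinctBlocks m n d) ⟩
  (n C suc d) * m ^ suc d + m * ((n C d) * m ^ d)
    ≡⟨ pascal-power n m d ⟩
  (suc n C suc d) * m ^ suc d ∎
  where open ≡-Reasoning

countIs-gapsInDistinctBlocks : ∀ m n d → CountIs (GapsInDistinctBlocks m n d) ((n C d) * m ^ d)
countIs-gapsInDistinctBlocks m n d =
  subst (CountIs _) (count-gapsInDistinctBlocks m n d) (countIs-count (gapsInDistinctBlocks? m n d))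

-- Connected edge covers of the friendship graph

module _ {G : Graph} {S : Subset (E G)} where

  reach-trans : ∀ {u v w} → Reach G S u v → Reach G S v w → Reach G S u w
  reach-trans here                   r′ = r′
  reach-trans (step e e∈S u∈e w∈e r) r′ = step e e∈S u∈e w∈e (reach-trans r r′)

  reach-sym : ∀ {u v} → Reach G S u v → Reach G S v u
  reach-sym here                   = here
  reach-sym (step e e∈S u∈e w∈e r) = reach-trans (reach-sym r) (step e e∈S w∈e u∈e here)

  reach-covered : ∀ {u v} → Reach G S u v → u ≡ v ⊎ Covered G S u
  reach-covered here                 = inj₁ refl
  reach-covered (step e e∈S u∈e _ _) = inj₂ (e , e∈S , u∈e)

  reach-preserves : (P : V G → Set) →
    (∀ {e u w} → e ∈ S → Incident G u e → Incident G w e → P u → P w) →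
    ∀ {u v} → Reach G S u v → P u → P v
  reach-preserves P closed here                   Pu = Pu
  reach-preserves P closed (step e e∈S u∈e w∈e r) Pu = reach-preserves P closed r (closed e∈S u∈e w∈e Pu)

  hub⇒isConnectedEdgeCover : (c v₀ : V G) → v₀ ≢ c → (∀ v → Reach G S v c) → IsConnectedEdgeCover G S
  hub⇒isConnectedEdgeCover c v₀ v₀≢c to-c = covered , λ u v _ _ → reach-trans (to-c u) (reach-sym (to-c v))
    where
    c-covered : Covered G S c
    c-covered with reach-covered (reach-sym (to-c v₀))
    ... | inj₁ c≡v₀ = contradiction (sym c≡v₀) v₀≢c
    ... | inj₂ cov  = cov

    covered : ∀ v → Covered G S v
    covered v with reach-covered (to-c v)
    ... | inj₁ refl = c-covered
    ... | inj₂ cov  = cov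

pos-last : ∀ n m (j : Fin n) → pos n m j m ≡ center
pos-last n zero    j = refl
pos-last n (suc m) j with m <? m
... | yes m<m = contradiction m<m (<-irrefl refl)
... | no  _   = refl

pos-node : ∀ {n m} (j : Fin n) (q : Fin (m ∸ 1)) → pos n m j (suc (toℕ q)) ≡ node j q
pos-node {m = m} j q with toℕ q <? m ∸ 1
... | yes q<m = cong (node j) (fromℕ<-toℕ q q<m)
... | no  q≮m = contradiction (toℕ<n q) q≮m

pos-suc : ∀ {n m} (j : Fin n) {p} → suc p < m →
          ∃ λ (q : Fin (m ∸ 1)) → toℕ q ≡ p × pos n m j (suc p) ≡ node j q
pos-suc {m = suc m} j {p} (s≤s p<m) with p <? m
... | yes p<m′ = fromℕ< p<m′ , toℕ-fromℕ< p<m′ , refl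
... | no  p≮m  = contradiction p<m p≮m

pos≡node : ∀ {n m} {j j′ : Fin n} {p} {q : Fin (m ∸ 1)} →
           pos n m j′ p ≡ node j q → j′ ≡ j × p ≡ suc (toℕ q)
pos≡node {m = m} {p = suc p} eq with p <? m ∸ 1
pos≡node {p = suc p} refl | yes p<m = refl , cong suc (sym (toℕ-fromℕ< p<m))

1+toℕ<n : ∀ {m} (q : Fin (m ∸ 1)) → suc (toℕ q) < m
1+toℕ<n {suc m} q = s≤s (toℕ<n q)

CycleIncident : ∀ {n m} → Fin n → Fin m → FVertex n m → Set
CycleIncident {n} {m} j k v = pos n m j (toℕ k) ≡ v ⊎ pos n m j (suc (toℕ k)) ≡ v

incident-combine : ∀ {n m} (j : Fin n) (k : Fin m) {v} →
                   Incident (friendship n m) v (combine j k) ⇔ CycleIncident j k v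
incident-combine {n} {m} j k {v} =
  mk⇔ (subst Inc (remQuot-combine j k)) (subst Inc (sym (remQuot-combine j k)))
  where
  Inc : Fin n × Fin m → Set
  Inc (j′ , k′) = CycleIncident j′ k′ v

edge-combine : ∀ {n m} {P : Fin (n * m) → Set} → (∀ j k → P (combine j k)) → ∀ e → P e
edge-combine {n} {m} {P} P-combine e =
  subst P (combine-remQuot {n} m e) (P-combine (proj₁ (remQuot {n} m e)) (proj₂ (remQuot {n} m e)))

module _ {n m} {S : Subset (n * m)} where

  cycle-edge : ∀ (j : Fin n) (k : Fin m) → combine j k ∈ S →
    Reach (friendship n m) S (pos n m j (toℕ k)) (pos n m j (suc (toℕ k)))
  cycle-edge j k jk∈S =
    step (combine j k) jk∈S (from (incident-combine j k) (inj₁ refl))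
                            (from (incident-combine j k) (inj₂ refl)) here

  cycle-walk : ∀ (j : Fin n) {a b} → a ≤′ b → b ≤ m →
    (∀ (k : Fin m) → a ≤ toℕ k → toℕ k < b → combine j k ∈ S) →
    Reach (friendship n m) S (pos n m j a) (pos n m j b)
  cycle-walk j ≤′-refl            _   _     = here
  cycle-walk j (≤′-step {b} a≤′b) b<m edges = reach-trans
    (cycle-walk j a≤′b (<⇒≤ b<m) (λ k a≤k k<b → edges k a≤k (m<n⇒m<1+n k<b)))
    (subst₂ (Reach (friendship n m) S) (cong (pos n m j) k≡b) (cong (pos n m j ∘ suc) k≡b)
      (cycle-edge j k (edges k (subst (_ ≤_) (sym k≡b) (≤′⇒≤ a≤′b)) (s≤s (≤-reflexive k≡b)))))
    where
    k = fromℕ< b<m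
    k≡b = toℕ-fromℕ< b<m

  node-reaches-center : ∀ (j : Fin n) g → (∀ (k : Fin m) → toℕ k ≢ g → combine j k ∈ S) →
    ∀ q → Reach (friendship n m) S (node j q) center
  node-reaches-center j g edges q =
    subst (λ v → Reach (friendship n m) S v center) (pos-node j q) (via (p ≤? g))
    where
    p = suc (toℕ q)
    via : Dec (p ≤ g) → Reach (friendship n m) S (pos n m j p) center
    via (yes p≤g) = reach-sym (cycle-walk j z≤′n (<⇒≤ (1+toℕ<n q))
                                (λ k _ k<p → edges k (<⇒≢ (<-≤-trans k<p p≤g))))
    via (no  p≰g) = subst (Reach (friendship n m) S (pos n m j p)) (pos-last n m j)
                      (cycle-walk j (≤⇒≤′ (<⇒≤ (1+toℕ<n q))) ≤-refl
                        (λ k p≤k _ → edges k (λ k≡g → p≰g (subst (p ≤_) k≡g p≤k))))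

  atMostOneGapPerBlock⇒isConnectedEdgeCover : 1 ≤ n → 2 ≤ m →
    AtMostOneGapPerBlock m n S → IsConnectedEdgeCover (friendship n m) S
  atMostOneGapPerBlock⇒isConnectedEdgeCover 1≤n 2≤m gaps≤1 =
    hub⇒isConnectedEdgeCover center (node (fromℕ< 1≤n) (fromℕ< (∸-monoˡ-≤ 1 2≤m))) (λ ()) to-center
    where
    to-center : ∀ v → Reach (friendship n m) S v center
    to-center center     = here
    to-center (node j q) with g , ∈block ← ∣∁p∣≤1⇒∈-except (block m S j) (gaps≤1 j) =
      node-reaches-center j g (λ k k≢g → ∈-block⁻ S j (∈block k k≢g)) q

  module _ (j : Fin n) {a b : Fin m} (a∉S : combine j a ∉ S) (b∉S : combine j b ∉ S) where

    InSegment : FVertex n m → Set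
    InSegment v = ∃ λ (q : Fin (m ∸ 1)) → toℕ a ≤ toℕ q × toℕ q < toℕ b × node j q ≡ v

    pos∈segment : ∀ {p} → toℕ a < p → p ≤ toℕ b → InSegment (pos n m j p)
    pos∈segment {suc p} (s≤s a≤p) p<b with q , q≡p , pos≡q ← pos-suc j (≤-<-trans p<b (toℕ<n b)) =
      q , subst (toℕ a ≤_) (sym q≡p) a≤p , subst (_< toℕ b) (sym q≡p) p<b , sym pos≡q

    present≢gap : ∀ {k g} → combine j k ∈ S → combine j g ∉ S → toℕ k ≢ toℕ g
    present≢gap k∈S g∉S k≡g = g∉S (subst (λ k → combine j k ∈ S) (toℕ-injective k≡g) k∈S)

    edge-at-segment : ∀ {j′ k′ q} → combine j′ k′ ∈ S → CycleIncident j′ k′ (node j q) →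
      toℕ a ≤ toℕ q → toℕ q < toℕ b → j′ ≡ j × toℕ a < toℕ k′ × toℕ k′ < toℕ b
    edge-at-segment {j′} {k′} k∈S (inj₁ pos≡q) a≤q q<b
      with refl , k≡1+q ← pos≡node {j′ = j′} {toℕ k′} pos≡q =
      refl , subst (toℕ a <_) (sym k≡1+q) (s≤s a≤q) ,
      ≤∧≢⇒< (subst (_≤ toℕ b) (sym k≡1+q) q<b) (present≢gap k∈S b∉S)
    edge-at-segment {j′} {k′} k∈S (inj₂ pos≡q) a≤q q<b
      with refl , 1+k≡1+q ← pos≡node {j′ = j′} {suc (toℕ k′)} pos≡q =
      refl , ≤∧≢⇒< (subst (toℕ a ≤_) (sym k≡q) a≤q) (present≢gap k∈S a∉S ∘ sym) ,
      subst (_< toℕ b) (sym k≡q) q<b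
      where k≡q = suc-injective 1+k≡1+q

    segment-closed-combine : ∀ j′ k′ {u w} → combine j′ k′ ∈ S →
      CycleIncident j′ k′ u → CycleIncident j′ k′ w → InSegment u → InSegment w
    segment-closed-combine j′ k′ k∈S u-inc w-inc (q , a≤q , q<b , refl)
      with refl , a<k , k<b ← edge-at-segment k∈S u-inc a≤q q<b | w-inc
    ... | inj₁ refl = pos∈segment a<k (<⇒≤ k<b)
    ... | inj₂ refl = pos∈segment (m<n⇒m<1+n a<k) k<b

    segment-closed : ∀ {e u w} → e ∈ S → Incident (friendship n m) u e → Incident (friendship n m) w e →
      InSegment u → InSegment w
    segment-closed {e} {u} {w} =
      edge-combine {P = λ e → e ∈ S → Inc u e → Inc w e → InSegment u → InSegment w}
        (λ j′ k′ k∈S u∈e w∈e → segment-closed-combine j′ k′ k∈S (to (incident-combine j′ k′) u∈e)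
                                                                  (to (incident-combine j′ k′) w∈e))
        e
      where Inc = Incident (friendship n m)

    two-gaps⇒¬isConnectedEdgeCover : toℕ a < toℕ b → ¬ IsConnectedEdgeCover (friendship n m) S
    two-gaps⇒¬isConnectedEdgeCover a<b (covered , connected)
      with reach-preserves InSegment segment-closed (connected _ center (covered _) (covered _))
                           (pos∈segment ≤-refl a<b)
    ... | _ , _ , _ , ()

  isConnectedEdgeCover⇒atMostOneGapPerBlock :
    IsConnectedEdgeCover (friendship n m) S → AtMostOneGapPerBlock m n S
  isConnectedEdgeCover⇒atMostOneGapPerBlock cec j =
    gap-unique⇒∣∁p∣≤1 (block m S j) (λ a∉ b∉ → gaps-equal (a∉ ∘ ∈-block⁺ S j) (b∉ ∘ ∈-block⁺ S j))
    where
    gaps-equal : ∀ {a b} → combine j a ∉ S → combine j b ∉ S → a ≡ b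
    gaps-equal {a} {b} a∉S b∉S with Fin.<-cmp a b
    ... | tri< a<b _ _ = contradiction cec (two-gaps⇒¬isConnectedEdgeCover j a∉S b∉S a<b)
    ... | tri≈ _ a≡b _ = a≡b
    ... | tri> _ _ b<a = contradiction cec (two-gaps⇒¬isConnectedEdgeCover j b∉S a∉S b<a)

isConnectedEdgeCover⇔atMostOneGapPerBlock : ∀ {n m} {S : Subset (n * m)} → 1 ≤ n → 2 ≤ m →
  IsConnectedEdgeCover (friendship n m) S ⇔ AtMostOneGapPerBlock m n S
isConnectedEdgeCover⇔atMostOneGapPerBlock 1≤n 2≤m =
  mk⇔ isConnectedEdgeCover⇒atMostOneGapPerBlock (atMostOneGapPerBlock⇒isConnectedEdgeCover 1≤n 2≤m)

-- Coefficients of the right-hand side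

sum-applyUpTo-zero : ∀ N {f : ℕ → ℕ} → (∀ j → j < N → f j ≡ 0) → sum (applyUpTo f N) ≡ 0
sum-applyUpTo-zero zero    _   = refl
sum-applyUpTo-zero (suc N) f≡0 =
  cong₂ _+_ (f≡0 0 (s≤s z≤n)) (sum-applyUpTo-zero N (λ j j<N → f≡0 (suc j) (s≤s j<N)))

sum-applyUpTo-single : ∀ N {f : ℕ → ℕ} d → (∀ j → j < N → j ≢ d → f j ≡ 0) → (N ≤ d → f d ≡ 0) →
                       sum (applyUpTo f N) ≡ f d
sum-applyUpTo-single zero    d       _   fd≡0 = sym (fd≡0 z≤n)
sum-applyUpTo-single (suc N) {f} zero    f≡0 _ =
  trans (cong (f 0 +_) (sum-applyUpTo-zero N (λ j j<N → f≡0 (suc j) (s≤s j<N) (λ ()))))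
        (+-identityʳ (f 0))
sum-applyUpTo-single (suc N) (suc d) f≡0 fd≡0 =
  cong₂ _+_ (f≡0 0 (s≤s z≤n) (λ ()))
            (sum-applyUpTo-single N d (λ j j<N j≢d → f≡0 (suc j) (s≤s j<N) (j≢d ∘ suc-injective))
                                      (fd≡0 ∘ s≤s))

module _ (n m i : ℕ) where

  rhsTerm : ℕ → ℕ
  rhsTerm j = if ⌊ (m * n ∸ j) ≟ i ⌋ then (n C j) * m ^ j else 0

  rhsTerm-≢ : ∀ j → m * n ∸ j ≢ i → rhsTerm j ≡ 0
  rhsTerm-≢ j ≢i with (m * n ∸ j) ≟ i
  ... | yes ≡i = contradiction ≡i ≢i
  ... | no  _  = refl

  rhsTerm-≡ : ∀ j → m * n ∸ j ≡ i → rhsTerm j ≡ (n C j) * m ^ j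
  rhsTerm-≡ j ≡i with (m * n ∸ j) ≟ i
  ... | yes _  = refl
  ... | no ≢i  = contradiction ≡i ≢i

  rhsCoeff≡sum : rhsCoeff n m i ≡ sum (applyUpTo rhsTerm (suc n))
  rhsCoeff≡sum = cong sum (map-upTo rhsTerm (suc n))

  rhsCoeff-> : n * m < i → rhsCoeff n m i ≡ 0
  rhsCoeff-> nm<i = trans rhsCoeff≡sum (sum-applyUpTo-zero (suc n) (λ j _ → rhsTerm-≢ j (mn∸j≢i j)))
    where
    mn∸j≢i : ∀ j → m * n ∸ j ≢ i
    mn∸j≢i j mn∸j≡i =
      <⇒≱ nm<i (subst (_≤ n * m) mn∸j≡i (subst (m * n ∸ j ≤_) (*-comm m n) (m∸n≤m (m * n) j)))

  mn∸j≡i⇒j≡nm∸i : 1 ≤ m → ∀ j → j ≤ n → m * n ∸ j ≡ i → j ≡ n * m ∸ i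
  mn∸j≡i⇒j≡nm∸i 1≤m j j≤n mn∸j≡i = sym (begin
    n * m ∸ i            ≡⟨ cong (n * m ∸_) (sym mn∸j≡i) ⟩
    n * m ∸ (m * n ∸ j)  ≡⟨ cong (λ x → n * m ∸ (x ∸ j)) (*-comm m n) ⟩
    n * m ∸ (n * m ∸ j)  ≡⟨ m∸[m∸n]≡n (≤-trans j≤n (m≤m*n n m {{>-nonZero 1≤m}})) ⟩
    j                    ∎)
    where open ≡-Reasoning

  rhsCoeff-≤ : 1 ≤ m → i ≤ n * m → rhsCoeff n m i ≡ (n C (n * m ∸ i)) * m ^ (n * m ∸ i)
  rhsCoeff-≤ 1≤m i≤nm = begin
    rhsCoeff n m i
      ≡⟨ rhsCoeff≡sum ⟩
    sum (applyUpTo rhsTerm (suc n))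
      ≡⟨ sum-applyUpTo-single (suc n) d
           (λ j j<1+n j≢d → rhsTerm-≢ j (j≢d ∘ mn∸j≡i⇒j≡nm∸i 1≤m j (s≤s⁻¹ j<1+n)))
           (λ n<d → trans rhsTerm-d (cong (_* m ^ d) (k>n⇒nCk≡0 n<d))) ⟩
    rhsTerm d
      ≡⟨ rhsTerm-d ⟩
    (n C d) * m ^ d ∎
    where
    open ≡-Reasoning
    d = n * m ∸ i
    rhsTerm-d : rhsTerm d ≡ (n C d) * m ^ d
    rhsTerm-d = rhsTerm-≡ d (trans (cong (_∸ d) (*-comm m n)) (m∸[m∸n]≡n i≤nm))

mainTheorem2 : (n m : ℕ) → 1 ≤ n → 3 ≤ m →
    (i : ℕ) → ecIs (friendship n m) i (rhsCoeff n m i)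
mainTheorem2 n m 1≤n 3≤m i with i ≤? n * m
... | no  i≰nm = subst (ecIs (friendship n m) i) (sym (rhsCoeff-> n m i (≰⇒> i≰nm)))
  (countIs-none (λ S (_ , |S|≡i) → i≰nm (subst (_≤ n * m) |S|≡i (∣p∣≤n S))))
... | yes i≤nm = subst (ecIs (friendship n m) i) (sym (rhsCoeff-≤ n m i 1≤m i≤nm))
  (countIs-cong (λ S → ⇔-sym (isConnectedEdgeCover⇔atMostOneGapPerBlock 1≤n 2≤m)
                         ×-⇔ ∣∁p∣≡k∸i⇔∣p∣≡i S i≤nm)
                (countIs-gapsInDistinctBlocks m n (n * m ∸ i)))
  where
  2≤m : 2 ≤ m
  2≤m = <⇒≤ 3≤m
  1≤m : 1 ≤ m
  1≤m = <⇒≤ 2≤m
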